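{- Let $\sigma\le\tau$ in the consecutive pattern poset $S$, let $n=|\tau|-|\sigma|$, and let $C:\tau=\rho_0\to\rho_1\to\cdots\to\rho_n=\sigma$ be a maximal chain of $[\sigma,\tau]$ with chain id $l_1l_2\ldots l_n$. If $1\le i\le n-1$ and $\rho_i$ is a strong descent of $C$ (i.e. $l_i>l_{i+1}+1$), then the one-element interval $C(\rho_{i-1},\rho_{i+1})=\{\rho_i\}$ is a minimal skipped interval (MSI) of $C$, with respect to the lexicographic order of chain ids on the maximal chains of $[\sigma,\tau]$.
   Context: For $d\ge1$, $S_d$ is the set of permutations of $\{1,\dots,d\}$ in one-line notation, $S=\bigcup_{d>0}S_d$, and $|\tau|=d$ for $\tau\in S_d$. The standard form of a sequence of distinct integers $s(1)\ldots s(k)$ is the permutation in $S_k$ whose entries are in the same relative order. The consecutive pattern poset orders $S$ by $\sigma\le\tau$ ($\sigma\in S_k$, $\tau\in S_d$) iff for some $i$ the standard form of $\tau(i+1)\ldots\tau(i+k)$ equals $\sigma$. A permutation is monotone if its entries are strictly increasing or strictly decreasing. In a maximal chain $\tau=\rho_0\to\cdots\to\rho_n=\sigma$ ($\to$ denotes a cover, $|\rho_i|=|\tau|-i$), the chain id $l_1\ldots l_n$ is defined inductively by windows of positions of $\tau$: $W_0=\{1,\dots,|\tau|\}$; given $W_{i-1}=\{a,\dots,b\}$ with the standard form of $\tau(a)\ldots\tau(b)$ equal to $\rho_{i-1}$: if $\rho_{i-1}$ is not monotone, exactly one of the standard forms of $\tau(a+1)\ldots\tau(b)$ and $\tau(a)\ldots\tau(b-1)$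 equals $\rho_i$; in the first case put $l_i=a$, $W_i=\{a+1,\dots,b\}$, in the second $l_i=b$, $W_i=\{a,\dots,b-1\}$; if $\rho_{i-1}$ is monotone put $l_i=a$, $W_i=\{a+1,\dots,b\}$. Maximal chains of $[\sigma,\tau]$ are totally ordered by the lexicographic order of their chain ids. For $0\le i<j\le n$, $C(\rho_i,\rho_j)=\{\rho_{i+1},\dots,\rho_{j-1}\}$. A nonempty $C(\rho_i,\rho_j)$ is a skipped interval of $C$ if the set of elements of $C$ not in $C(\rho_i,\rho_j)$ is contained in some maximal chain $C'$ of $[\sigma,\tau]$ lexicographically earlier than $C$; it is a minimal skipped interval (MSI) if it properly contains no other skipped interval of $C$. For $1\le i\le n-1$, $\rho_i$ is a descent if $l_i>l_{i+1}$, a strong descent if $l_i>l_{i+1}+1$, a weak descent if $l_i=l_{i+1}+1$, and an ascent if $l_i<l_{i+1}$. -}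

module Defs where

open import Data.Nat using (ℕ; zero; suc; _+_; _∸_; _≤_; _<_; _<?_; _≟_; _<ᵇ_)
open import Data.Bool using (Bool; true; false; _∧_; _∨_; if_then_else_)
open import Data.List using (List; []; _∷_; length; map; filter; take; drop; upTo; head; last; _++_)
open import Data.List.Properties using (≡-dec)
open import Data.List.Relation.Unary.All using (All)
open import Data.List.Relation.Unary.Linked using (Linked)
open import Data.List.Relation.Binary.Permutation.Propositional using (_↭_)
open import Data.List.Relation.Binary.Subset.Propositional using (_⊆_)
open import Data.Maybe using (Maybe; just; nothing)
open import Data.Product using (Σ; ∃; ∃-syntax; _×_; _,_)
open import Data.Sum using (_⊎_)
open import Relation.Nullary using (¬_; does)
open import Relation.Binary.PropositionalEquality using (_≡_; _≢_)

-- Permutations are written in one-line notation as lists of naturals.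
-- A list p is a permutation in S_d (d = length p ≥ 1) iff it is a rearrangement of 1..d.
IsPerm : List ℕ → Set
IsPerm p = 1 ≤ length p × p ↭ map suc (upTo (length p))

std : List ℕ → List ℕ
std s = map (λ x → suc (length (filter (_<? x) s))) s

_≼_ : List ℕ → List ℕ → Set
σ ≼ τ = ∃[ i ] (i + length σ ≤ length τ × std (take (length σ) (drop i τ)) ≡ σ)

CoveredBy : List ℕ → List ℕ → Set
CoveredBy ρ' ρ = ρ' ≼ ρ × ρ' ≢ ρ ×
  (∀ π → IsPerm π → ρ' ≼ π → π ≼ ρ → π ≡ ρ' ⊎ π ≡ ρ)

-- A maximal chain of [σ,τ]: τ = ρ₀ → ρ₁ → ⋯ → ρₙ = σ, stored as the list ρ₀ … ρₙ
MaxChain : List ℕ → List ℕ → List (List ℕ) → Set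
MaxChain σ τ C = head C ≡ just τ × last C ≡ just σ × All IsPerm C ×
  Linked (λ a b → CoveredBy b a) C

increasing : List ℕ → Bool
increasing (x ∷ y ∷ r) = (x <ᵇ y) ∧ increasing (y ∷ r)
increasing _ = true

decreasing : List ℕ → Bool
decreasing (x ∷ y ∷ r) = (y <ᵇ x) ∧ decreasing (y ∷ r)
decreasing _ = true

monotone : List ℕ → Bool
monotone p = increasing p ∨ decreasing p

-- chain id: current window W = {a,…,b} (1-indexed positions of τ), prev = ρ_{i-1}
chainIdGo : List ℕ → ℕ → ℕ → List ℕ → List (List ℕ) → List ℕ
chainIdGo τ a b prev [] = []
chainIdGo τ a b prev (ρ ∷ rs) =
  if monotone prev
  then a ∷ chainIdGo τ (suc a) b ρ rs
  else (if does (≡-dec _≟_ (std (take (b ∸ a) (drop a τ))) ρ)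
        then a ∷ chainIdGo τ (suc a) b ρ rs
        else b ∷ chainIdGo τ a (b ∸ 1) ρ rs)

chainId : List ℕ → List (List ℕ) → List ℕ
chainId τ [] = []
chainId τ (ρ₀ ∷ rs) = chainIdGo τ 1 (length τ) ρ₀ rs

data LexLt : List ℕ → List ℕ → Set where
  here  : ∀ {x y xs ys} → x < y → LexLt (x ∷ xs) (y ∷ ys)
  there : ∀ {x xs ys} → LexLt xs ys → LexLt (x ∷ xs) (x ∷ ys)

nth : {A : Set} → List A → ℕ → Maybe A
nth [] k = nothing
nth (x ∷ xs) zero = just x
nth (x ∷ xs) (suc k) = nth xs k

-- C(ρ_i, ρ_j) = {ρ_{i+1}, …, ρ_{j-1}}
intervalC : List (List ℕ) → ℕ → ℕ → List (List ℕ)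
intervalC C i j = take (j ∸ suc i) (drop (suc i) C)

outsideC : List (List ℕ) → ℕ → ℕ → List (List ℕ)
outsideC C i j = take (suc i) C ++ drop j C

Skipped : List ℕ → List ℕ → List (List ℕ) → ℕ → ℕ → Set
Skipped σ τ C i j = i < j × suc j ≤ length C × intervalC C i j ≢ [] ×
  ∃[ C' ] (MaxChain σ τ C' × LexLt (chainId τ C') (chainId τ C) × outsideC C i j ⊆ C')

MSI : List ℕ → List ℕ → List (List ℕ) → ℕ → ℕ → Set
MSI σ τ C i j = Skipped σ τ C i j ×
  (∀ i' j' → Skipped σ τ C i' j' →
     ¬ (intervalC C i' j' ⊆ intervalC C i j × ¬ (intervalC C i j ⊆ intervalC C i' j')))

-- While the chain id is computed along C = τ → ρ₁ → ⋯, the current pattern ρ is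
-- the standard form of a window {p+1, …, p+|ρ|} of positions of τ, and each cover ρ → ρ'
-- deletes one end of that window: the left end gets label p+1, the right end (possible
-- only for non-monotone ρ) gets label p+|ρ|.  At a strong descent l_i > l_{i+1} + 1 the
-- step into ρ_i must delete the right end and the step out of ρ_i the left end.  Deleting
-- the left end first gives a pattern x strictly between ρ_{i-1} and ρ_{i+1}; replacing ρ_i
-- by x yields a maximal chain whose chain id first differs at position i, where it has the
-- smaller label p+1.  Hence {ρ_i} is skipped, and as a singleton it is minimal.
module Submission where

open import Defs
open import Data.Nat using (ℕ; zero; suc; _+_; _∸_; _≤_; _<_; _≮_; _<?_; _≤?_; _≟_; _<ᵇ_; z≤n; s≤s)
open import Data.Nat.Properties
open import Data.Bool using (true; false; T; _∧_)
open import Data.Unit using (tt)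
open import Data.List using (List; []; _∷_; _++_; last; length; map; filter; take; drop; upTo; applyUpTo)
open import Data.List.Properties using (≡-dec; map-∘; map-cong-local; length-take; take-take; drop-drop; length-map; take-map; drop-map; take-all; map-id; map-upTo; upTo-∷ʳ; filter-accept; filter-reject; filter-all; filter-none; filter-notAll)
open import Data.List.Relation.Unary.All as All using (All; []; _∷_)
import Data.List.Relation.Unary.All.Properties as All
import Data.List.Relation.Unary.Any as Any
open import Data.List.Relation.Unary.Any using (here; there)
open import Data.List.Membership.Propositional using (_∈_)
open import Data.List.Membership.Propositional.Properties using (∈-map⁻; ∈-upTo⁻; ∈-upTo⁺; ∈-∃++)
open import Data.List.Membership.DecPropositional _≟_ using (_∈?_)
open import Data.List.Relation.Unary.Unique.Propositional using (Unique; []; _∷_)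
import Data.List.Relation.Unary.Unique.Propositional.Properties as Unique
open import Data.List.Relation.Binary.Permutation.Propositional using (_↭_; ↭-sym; ↭-trans; ↭-refl; prep; ↭⇒↭ₛ)
open import Data.List.Relation.Binary.Permutation.Propositional.Properties using (filter-↭; ↭-length; ∈-resp-↭; All-resp-↭; shift; ∷↭∷ʳ; map⁺)
import Data.List.Relation.Binary.Permutation.Setoid.Properties as PermSetoid
open import Data.List.Relation.Binary.Subset.Propositional using (_⊆_)
open import Data.List.Relation.Unary.Linked using (Linked; _∷_)
open import Data.List.Relation.Binary.Subset.Propositional.Properties using (⊆-refl; ++⁺ʳ; xs⊆x∷xs)
open import Data.Maybe using (just)
open import Data.Maybe.Properties using (just-injective)
open import Data.Product using (∃-syntax; _×_; _,_; proj₁; proj₂)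
open import Data.Sum using (_⊎_; inj₁; inj₂)
open import Function using (_∘_)
open import Relation.Nullary using (¬_; yes; no; does; contradiction)
open import Relation.Nullary.Decidable using (dec-true; dec-false)
open import Relation.Binary.Definitions using (tri<; tri≈; tri>)
open import Relation.Binary.PropositionalEquality using (_≡_; _≢_; refl; sym; trans; cong; cong₂; subst; subst₂; setoid; module ≡-Reasoning)

below : List ℕ → ℕ → ℕ
below s x = length (filter (_<? x) s)

rank : List ℕ → ℕ → ℕ
rank s x = suc (below s x)

below-∷-< : ∀ {z x} s → z < x → below (z ∷ s) x ≡ suc (below s x)
below-∷-< {x = x} s z<x = cong length (filter-accept (_<? x) z<x)

below-∷-≮ : ∀ {z x} s → z ≮ x → below (z ∷ s) x ≡ below s x
below-∷-≮ {x = x} s z≮x = cong length (filter-reject (_<? x) z≮x)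

below-mono : ∀ {x y} s → y ≤ x → below s y ≤ below s x
below-mono [] _ = z≤n
below-mono {x} {y} (z ∷ s) y≤x with z <? y | z <? x
... | yes z<y | yes z<x rewrite below-∷-< s z<y | below-∷-< s z<x = s≤s (below-mono s y≤x)
... | yes z<y | no z≮x  = contradiction (<-≤-trans z<y y≤x) z≮x
... | no z≮y  | yes z<x rewrite below-∷-≮ s z≮y | below-∷-< s z<x = m≤n⇒m≤1+n (below-mono s y≤x)
... | no z≮y  | no z≮x  rewrite below-∷-≮ s z≮y | below-∷-≮ s z≮x = below-mono s y≤x

below-strict : ∀ {x y} s → y < x → y ∈ s → below s y < below s x
below-strict {x} (z ∷ s) z<x (here refl)
  rewrite below-∷-≮ s (n≮n z) | below-∷-< s z<x = s≤s (below-mono s (<⇒≤ z<x))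
below-strict {x} {y} (z ∷ s) y<x (there y∈s) with z <? y | z <? x
... | yes z<y | yes z<x rewrite below-∷-< s z<y | below-∷-< s z<x = s≤s (below-strict s y<x y∈s)
... | yes z<y | no z≮x  = contradiction (<-trans z<y y<x) z≮x
... | no z≮y  | yes z<x rewrite below-∷-≮ s z≮y | below-∷-< s z<x = m<n⇒m<1+n (below-strict s y<x y∈s)
... | no z≮y  | no z≮x  rewrite below-∷-≮ s z≮y | below-∷-≮ s z≮x = below-strict s y<x y∈s

below-bound : ∀ {x} s → x ∈ s → below s x < length s
below-bound {x} s x∈s = filter-notAll (_<? x) s (Any.map (λ { refl → n≮n x }) x∈s)

below-↭ : ∀ x {u v} → u ↭ v → below u x ≡ below v x
below-↭ x u↭v = ↭-length (filter-↭ (_<? x) u↭v)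

StrictlyIncreasingOn : List ℕ → (ℕ → ℕ) → Set
StrictlyIncreasingOn u f = ∀ {x y} → x ∈ u → y ∈ u → y < x → f y < f x

module _ {u : List ℕ} {f : ℕ → ℕ} (inc : StrictlyIncreasingOn u f) where

  reflects : ∀ {x y} → x ∈ u → y ∈ u → f y < f x → y < x
  reflects {x} {y} x∈u y∈u fy<fx with <-cmp y x
  ... | tri< y<x _ _ = y<x
  ... | tri≈ _ refl _ = contradiction fy<fx (n≮n (f x))
  ... | tri> _ _ x<y = contradiction fy<fx (<-asym (inc y∈u x∈u x<y))

  injective : ∀ {x y} → x ∈ u → y ∈ u → f x ≡ f y → x ≡ y
  injective {x} {y} x∈u y∈u fx≡fy with <-cmp x y
  ... | tri< x<y _ _ = contradiction fx≡fy (<⇒≢ (inc y∈u x∈u x<y))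
  ... | tri≈ _ x≡y _ = x≡y
  ... | tri> _ _ y<x = contradiction (sym fx≡fy) (<⇒≢ (inc x∈u y∈u y<x))

  below-map : ∀ {x} → x ∈ u → ∀ v → v ⊆ u → below (map f v) (f x) ≡ below v x
  below-map x∈u [] _ = refl
  below-map {x} x∈u (y ∷ v) v⊆u with y <? x
  ... | yes y<x rewrite below-∷-< (map f v) (inc x∈u (v⊆u (here refl)) y<x) | below-∷-< v y<x =
    cong suc (below-map x∈u v (v⊆u ∘ there))
  ... | no y≮x rewrite below-∷-≮ (map f v) (y≮x ∘ reflects x∈u (v⊆u (here refl))) | below-∷-≮ v y≮x =
    below-map x∈u v (v⊆u ∘ there)

  std-map : ∀ {v} → v ⊆ u → std (map f v) ≡ std v
  std-map {v} v⊆u = begin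
    map (rank (map f v)) (map f v) ≡⟨ map-∘ v ⟨
    map (rank (map f v) ∘ f) v     ≡⟨ map-cong-local (All.tabulate (λ y∈v → cong suc (below-map (v⊆u y∈v) v v⊆u))) ⟩
    map (rank v) v                 ∎
    where open ≡-Reasoning

  unique-map : ∀ {v} → v ⊆ u → Unique v → Unique (map f v)
  unique-map v⊆u [] = []
  unique-map v⊆u (x≢v ∷ v!) =
    All.map⁺ (All.tabulate (λ y∈v fx≡fy → All.lookup x≢v y∈v (injective (v⊆u (here refl)) (v⊆u (there y∈v)) fx≡fy)))
      ∷ unique-map (v⊆u ∘ there) v!

below-increasing : ∀ s → StrictlyIncreasingOn s (below s)
below-increasing s _ y∈s y<x = below-strict s y<x y∈s

rank-increasing : ∀ s → StrictlyIncreasingOn s (rank s)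
rank-increasing s x∈s y∈s y<x = s≤s (below-increasing s x∈s y∈s y<x)

window-⊆ : ∀ m j (s : List ℕ) → take m (drop j s) ⊆ s
window-⊆ (suc m) zero (x ∷ s) (here e) = here e
window-⊆ (suc m) zero (x ∷ s) (there y∈) = there (window-⊆ m zero s y∈)
window-⊆ m (suc j) (x ∷ s) y∈ = there (window-⊆ m j s y∈)

std-window-std : ∀ m j s → std (take m (drop j (std s))) ≡ std (take m (drop j s))
std-window-std m j s = begin
  std (take m (drop j (map (rank s) s))) ≡⟨ cong (std ∘ take m) (drop-map j s) ⟩
  std (take m (map (rank s) (drop j s))) ≡⟨ cong std (take-map m (drop j s)) ⟩
  std (map (rank s) (take m (drop j s))) ≡⟨ std-map (rank-increasing s) (window-⊆ m j s) ⟩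
  std (take m (drop j s))                ∎
  where open ≡-Reasoning

suc-increasing : ∀ u → StrictlyIncreasingOn u suc
suc-increasing u _ _ = s≤s

perm-unique : ∀ {p} → IsPerm p → Unique p
perm-unique {p} (_ , p↭) = PermSetoid.Unique-resp-↭ (setoid ℕ) (↭⇒↭ₛ (↭-sym p↭))
  (unique-map (suc-increasing (upTo (length p))) ⊆-refl (Unique.upTo⁺ (length p)))

below-upTo : ∀ {n y} → y < n → below (upTo n) y ≡ y
below-upTo {n} {zero} _ = cong length (filter-none (_<? 0) {upTo n} (All.tabulate (λ _ ())))
below-upTo {suc n} {suc y} (s≤s y<n) = cong suc (begin
  below (applyUpTo suc n) (suc y)   ≡⟨ cong (λ v → below v (suc y)) (map-upTo suc n) ⟨
  below (map suc (upTo n)) (suc y)  ≡⟨ below-map (suc-increasing (upTo n)) (∈-upTo⁺ y<n) (upTo n) ⊆-refl ⟩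
  below (upTo n) y                  ≡⟨ below-upTo y<n ⟩
  y                                 ∎)
  where open ≡-Reasoning

std-perm : ∀ {p} → IsPerm p → std p ≡ p
std-perm {p} (_ , p↭) = trans (map-cong-local (All.tabulate rank≡)) (map-id p)
  where
  n = length p
  rank≡ : ∀ {x} → x ∈ p → rank p x ≡ x
  rank≡ {x} x∈p with ∈-map⁻ suc (∈-resp-↭ p↭ x∈p)
  ... | y , y∈ , refl = cong suc (begin
    below p (suc y)                   ≡⟨ below-↭ (suc y) p↭ ⟩
    below (map suc (upTo n)) (suc y)  ≡⟨ below-map (suc-increasing (upTo n)) y∈ (upTo n) ⊆-refl ⟩
    below (upTo n) y                  ≡⟨ below-upTo (∈-upTo⁻ y∈) ⟩
    y                                 ∎)
    where open ≡-Reasoning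

-- Pigeonhole: n distinct naturals below n are a rearrangement of 0, …, n-1.
-- An upper bound k+1 that is not attained is an upper bound k.
tighten : ∀ {k xs} → All (k ≢_) xs → All (_< suc k) xs → All (_< k) xs
tighten [] [] = []
tighten (k≢x ∷ k≢xs) (x<k+1 ∷ xs<k+1) with m≤n⇒m<n∨m≡n (m<1+n⇒m≤n x<k+1)
... | inj₁ x<k = x<k ∷ tighten k≢xs xs<k+1
... | inj₂ x≡k = contradiction (sym x≡k) k≢x

split-top : ∀ {k xs} → Unique xs → All (_< suc k) xs →
  (∃[ ys ] (xs ↭ k ∷ ys × Unique ys × All (_< k) ys)) ⊎ All (_< k) xs
split-top {k} {xs} xs! xs<k+1 with k ∈? xs
... | no k∉xs = inj₂ (tighten (All.¬Any⇒All¬ xs k∉xs) xs<k+1)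
... | yes k∈xs with ∈-∃++ k∈xs
...   | as , bs , refl with PermSetoid.Unique-resp-↭ (setoid ℕ) (↭⇒↭ₛ (shift k as bs)) xs!
                          | All-resp-↭ (shift k as bs) xs<k+1
...     | k≢ys ∷ ys! | _ ∷ ys<k+1 = inj₁ (as ++ bs , shift k as bs , ys! , tighten k≢ys ys<k+1)

unique-bounded-length : ∀ k {xs} → Unique xs → All (_< k) xs → length xs ≤ k
unique-bounded-length zero {[]} _ _ = z≤n
unique-bounded-length zero {x ∷ xs} _ (() ∷ _)
unique-bounded-length (suc k) xs! xs<k+1 with split-top xs! xs<k+1
... | inj₁ (ys , xs↭ , ys! , ys<k) =
  subst (_≤ suc k) (sym (↭-length xs↭)) (s≤s (unique-bounded-length k ys! ys<k))
... | inj₂ xs<k = m≤n⇒m≤1+n (unique-bounded-length k xs! xs<k)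

unique-bounded-↭ : ∀ k {xs} → Unique xs → All (_< k) xs → length xs ≡ k → xs ↭ upTo k
unique-bounded-↭ zero {[]} _ _ _ = ↭-refl
unique-bounded-↭ (suc k) xs! xs<k+1 len with split-top xs! xs<k+1
... | inj₁ (ys , xs↭ , ys! , ys<k) = ↭-trans xs↭ (↭-trans
  (prep k (unique-bounded-↭ k ys! ys<k (suc-injective (trans (sym (↭-length xs↭)) len))))
  (subst (k ∷ upTo k ↭_) (upTo-∷ʳ k) (∷↭∷ʳ k (upTo k))))
... | inj₂ xs<k = contradiction (subst (_≤ k) len (unique-bounded-length k xs! xs<k)) (n≮n k)

std-unique : ∀ {u} → Unique u → 1 ≤ length u → IsPerm (std u)
std-unique {u} u! 1≤n = subst (1 ≤_) (sym (length-map (rank u) u)) 1≤n ,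
  subst (_↭ map suc (upTo (length (std u)))) (sym (map-∘ u))
    (subst (λ n → map suc (map (below u) u) ↭ map suc (upTo n)) (sym (length-map (rank u) u))
      (map⁺ suc (unique-bounded-↭ (length u) belows! belows<n (length-map (below u) u))))
  where
  belows! : Unique (map (below u) u)
  belows! = unique-map (below-increasing u) ⊆-refl u!
  belows<n : All (_< length u) (map (below u) u)
  belows<n = All.map⁺ (All.tabulate (below-bound u))

-- Monotone lists: all increasing (decreasing) lists of one length share a pattern,
-- namely 1, 2, …, n (resp. n, …, 2, 1).
ascending : ℕ → List ℕ
ascending zero = []
ascending (suc n) = 1 ∷ map suc (ascending n)

descending : ℕ → List ℕ
descending zero = []
descending (suc n) = suc n ∷ descending n

std-∷-min : ∀ {x} r → All (x <_) r → std (x ∷ r) ≡ 1 ∷ map suc (std r)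
std-∷-min {x} r x<r = cong₂ _∷_
  (cong suc (trans (below-∷-≮ r (n≮n x)) (cong length (filter-none (_<? x) (All.map (λ x<z z<x → <-asym x<z z<x) x<r)))))
  (trans (map-cong-local (All.map (λ x<z → cong suc (below-∷-< r x<z)) x<r)) (map-∘ r))

std-∷-max : ∀ {x} r → All (_< x) r → std (x ∷ r) ≡ suc (length r) ∷ std r
std-∷-max {x} r r<x = cong₂ _∷_
  (cong suc (trans (below-∷-≮ r (n≮n x)) (cong length (filter-all (_<? x) r<x))))
  (map-cong-local (All.map (λ z<x → cong suc (below-∷-≮ r (<-asym z<x))) r<x))

<ᵇ-true : ∀ {x y} → (x <ᵇ y) ≡ true → x < y
<ᵇ-true {x} {y} e = <ᵇ⇒< x y (subst T (sym e) tt)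

∧-true : ∀ {a b} → (a ∧ b) ≡ true → a ≡ true × b ≡ true
∧-true {true} b≡true = refl , b≡true

increasing-∷ : ∀ x r → increasing (x ∷ r) ≡ true → All (x <_) r × increasing r ≡ true
increasing-∷ x [] _ = [] , refl
increasing-∷ x (y ∷ r) inc with ∧-true inc
... | x<ᵇy , inc-yr = (x<y ∷ All.map (<-trans x<y) (proj₁ (increasing-∷ y r inc-yr))) , inc-yr
  where x<y = <ᵇ-true x<ᵇy

decreasing-∷ : ∀ x r → decreasing (x ∷ r) ≡ true → All (_< x) r × decreasing r ≡ true
decreasing-∷ x [] _ = [] , refl
decreasing-∷ x (y ∷ r) dec with ∧-true dec
... | y<ᵇx , dec-yr = (y<x ∷ All.map (λ z<y → <-trans z<y y<x) (proj₁ (decreasing-∷ y r dec-yr))) , dec-yr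
  where y<x = <ᵇ-true y<ᵇx

increasing-take : ∀ m s → increasing s ≡ true → increasing (take m s) ≡ true
increasing-take zero s _ = refl
increasing-take (suc m) [] _ = refl
increasing-take (suc zero) (x ∷ r) _ = refl
increasing-take (suc (suc m)) (x ∷ []) _ = refl
increasing-take (suc (suc m)) (x ∷ y ∷ r) inc =
  cong₂ _∧_ (proj₁ (∧-true inc)) (increasing-take (suc m) (y ∷ r) (proj₂ (∧-true inc)))

decreasing-take : ∀ m s → decreasing s ≡ true → decreasing (take m s) ≡ true
decreasing-take zero s _ = refl
decreasing-take (suc m) [] _ = refl
decreasing-take (suc zero) (x ∷ r) _ = refl
decreasing-take (suc (suc m)) (x ∷ []) _ = refl
decreasing-take (suc (suc m)) (x ∷ y ∷ r) dec =
  cong₂ _∧_ (proj₁ (∧-true dec)) (decreasing-take (suc m) (y ∷ r) (proj₂ (∧-true dec)))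

std-increasing : ∀ s → increasing s ≡ true → std s ≡ ascending (length s)
std-increasing [] _ = refl
std-increasing (x ∷ r) inc with increasing-∷ x r inc
... | x<r , inc-r = trans (std-∷-min r x<r) (cong (λ v → 1 ∷ map suc v) (std-increasing r inc-r))

std-decreasing : ∀ s → decreasing s ≡ true → std s ≡ descending (length s)
std-decreasing [] _ = refl
std-decreasing (x ∷ r) dec with decreasing-∷ x r dec
... | r<x , dec-r = trans (std-∷-max r r<x) (cong (suc (length r) ∷_) (std-decreasing r dec-r))

length-init : ∀ x (r : List ℕ) → length (take (length r) (x ∷ r)) ≡ length r
length-init x r = trans (length-take (length r) (x ∷ r)) (m≤n⇒m⊓n≡m (n≤1+n (length r)))

monotone-windows : ∀ {m} s → monotone s ≡ true → length s ≡ suc m →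
  std (take m s) ≡ std (take m (drop 1 s))
monotone-windows (x ∷ r) mono refl rewrite take-all (length r) r ≤-refl with increasing (x ∷ r) in inc
... | true = begin
  std (take (length r) (x ∷ r))  ≡⟨ std-increasing _ (increasing-take (length r) (x ∷ r) inc) ⟩
  ascending _                    ≡⟨ cong ascending (length-init x r) ⟩
  ascending (length r)           ≡⟨ std-increasing r (proj₂ (increasing-∷ x r inc)) ⟨
  std r                          ∎
  where open ≡-Reasoning
... | false = begin
  std (take (length r) (x ∷ r))  ≡⟨ std-decreasing _ (decreasing-take (length r) (x ∷ r) mono) ⟩
  descending _                   ≡⟨ cong descending (length-init x r) ⟩
  descending (length r)          ≡⟨ std-decreasing r (proj₂ (decreasing-∷ x r mono)) ⟨
  std r                          ∎
  where open ≡-Reasoning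

record Window (s : List ℕ) (p : ℕ) (w : List ℕ) : Set where
  constructor window
  field
    fits : p + length w ≤ length s
    occurrence : w ≡ std (take (length w) (drop p s))

length-window : ∀ m j (s : List ℕ) → j + m ≤ length s → length (take m (drop j s)) ≡ m
length-window m zero s h = trans (length-take m s) (m≤n⇒m⊓n≡m h)
length-window m (suc j) (x ∷ s) (s≤s h) = length-window m j s h

length-std-window : ∀ m j (s : List ℕ) → j + m ≤ length s → length (std (take m (drop j s))) ≡ m
length-std-window m j s h = trans (length-map _ (take m (drop j s))) (length-window m j s h)

take-drop-take : ∀ m o n (v : List ℕ) → o + m ≤ n → take m (drop o (take n v)) ≡ take m (drop o v)
take-drop-take m zero n v h = trans (take-take m n v) (cong (λ k → take k v) (m≤n⇒m⊓n≡m h))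
take-drop-take m (suc o) (suc n) [] h = refl
take-drop-take m (suc o) (suc n) (x ∷ v) (s≤s h) = take-drop-take m o n v h

≼-intro : ∀ {π w} m o → length π ≡ m → o + m ≤ length w → std (take m (drop o w)) ≡ π → π ≼ w
≼-intro m o refl bound occ = o , bound , occ

window-pattern : ∀ m j s → j + m ≤ length s → std (take m (drop j s)) ≼ s
window-pattern m j s bound = ≼-intro m j (length-std-window m j s bound) bound refl

window-of-std : ∀ m p s → p + m ≤ length s → Window s p (std (take m (drop p s)))
window-of-std m p s bound = window (subst (λ k → p + k ≤ length s) (sym |w|) bound)
  (cong (λ k → std (take k (drop p s))) (sym |w|))
  where
  |w| : length (std (take m (drop p s))) ≡ m
  |w| = length-std-window m p s bound

window-whole : ∀ {s} → IsPerm s → Window s 0 s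
window-whole {s} s-perm = window ≤-refl (sym (trans (cong std (take-all (length s) s ≤-refl)) (std-perm s-perm)))

window-restrict : ∀ {s p w} → Window s p w → ∀ m o → o + m ≤ length w →
  std (take m (drop o w)) ≡ std (take m (drop (o + p) s))
window-restrict {s} {p} {w} (window _ w≡) m o bound = begin
  std (take m (drop o w))                                   ≡⟨ cong (λ v → std (take m (drop o v))) w≡ ⟩
  std (take m (drop o (std (take (length w) (drop p s)))))  ≡⟨ std-window-std m o _ ⟩
  std (take m (drop o (take (length w) (drop p s))))        ≡⟨ cong std (take-drop-take m o _ _ bound) ⟩
  std (take m (drop o (drop p s)))                          ≡⟨ cong (std ∘ take m) (drop-drop p o s) ⟩
  std (take m (drop (p + o) s))                             ≡⟨ cong (λ k → std (take m (drop k s))) (+-comm p o) ⟩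
  std (take m (drop (o + p) s))                             ∎
  where open ≡-Reasoning

sub-window : ∀ {s p w} → Window s p w → ∀ m o → o + m ≤ length w →
  std (take m (drop (o + p) s)) ≼ w
sub-window {s} {p} {w} win@(window w-bound _) m o bound =
  ≼-intro m o (length-std-window m (o + p) s s-bound) bound (window-restrict win m o bound)
  where
  s-bound : o + p + m ≤ length s
  s-bound = begin
    o + p + m    ≡⟨ cong (_+ m) (+-comm o p) ⟩
    p + o + m    ≡⟨ +-assoc p o m ⟩
    p + (o + m)  ≤⟨ +-monoʳ-≤ p bound ⟩
    p + length w ≤⟨ w-bound ⟩
    length s     ∎
    where open ≤-Reasoning

≼-length : ∀ {σ τ} → σ ≼ τ → length σ ≤ length τ
≼-length (i , bound , _) = m+n≤o⇒n≤o i bound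

≼-same-length : ∀ {σ τ} → IsPerm τ → σ ≼ τ → length σ ≡ length τ → σ ≡ τ
≼-same-length {σ} {τ} τ-perm (zero , _ , occ) same =
  trans (sym occ) (trans (cong (λ k → std (take k τ)) same) (sym (Window.occurrence (window-whole τ-perm))))
≼-same-length {σ} τ-perm (suc i , bound , _) same =
  contradiction (≤-trans (s≤s (m≤n+m (length σ) i)) (subst (suc i + length σ ≤_) (sym same) bound)) (n≮n (length σ))

cover-by-length : ∀ {lo hi} → IsPerm hi → lo ≼ hi → length hi ≡ suc (length lo) → CoveredBy lo hi
cover-by-length {lo} {hi} hi-perm lo≼hi longer = lo≼hi , lo≢hi , nothing-between
  where
  lo≢hi : lo ≢ hi
  lo≢hi refl = 1+n≢n (sym longer)
  nothing-between : ∀ π → IsPerm π → lo ≼ π → π ≼ hi → π ≡ lo ⊎ π ≡ hi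
  nothing-between π π-perm lo≼π π≼hi with m≤n⇒m<n∨m≡n (≼-length lo≼π)
  ... | inj₂ same = inj₁ (sym (≼-same-length π-perm lo≼π same))
  ... | inj₁ lo<π = inj₂ (≼-same-length hi-perm π≼hi
          (≤-antisym (≼-length π≼hi) (subst (_≤ length π) (sym longer) lo<π)))

widen : ∀ {lo hi} → IsPerm hi → ∀ o j → o ≤ 1 → j + suc (length lo) ≤ length hi →
  std (take (length lo) (drop (o + j) hi)) ≡ lo →
  ∃[ π ] (IsPerm π × lo ≼ π × π ≼ hi × length π ≡ suc (length lo))
widen {lo} {hi} hi-perm o j o≤1 bound occ =
  π , π-perm , subst (_≼ π) occ lo≼π , window-pattern (suc n) j hi bound , |π|
  where
  n = length lo
  π = std (take (suc n) (drop j hi))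
  |π| : length π ≡ suc n
  |π| = length-std-window (suc n) j hi bound
  π-perm : IsPerm π
  π-perm = std-unique (Unique.take⁺ (suc n) (Unique.drop⁺ j (perm-unique hi-perm)))
    (subst (1 ≤_) (sym (length-window (suc n) j hi bound)) (s≤s z≤n))
  lo≼π : std (take n (drop (o + j) hi)) ≼ π
  lo≼π = sub-window (window-of-std (suc n) j hi bound) n o
    (subst (o + n ≤_) (sym |π|) (+-monoˡ-≤ n o≤1))

pattern-between : ∀ {lo hi} → IsPerm hi → lo ≼ hi → 2 + length lo ≤ length hi →
  ∃[ π ] (IsPerm π × lo ≼ π × π ≼ hi × length π ≡ suc (length lo))
pattern-between hi-perm (zero , _ , occ) big = widen hi-perm 0 0 z≤n (≤-trans (n≤1+n _) big) occ
pattern-between {lo} {hi} hi-perm (suc j , bound , occ) big with suc j + suc (length lo) ≤? length hi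
... | yes fits = widen hi-perm 0 (suc j) z≤n fits occ
... | no _ = widen hi-perm 1 j ≤-refl (subst (_≤ length hi) (sym (+-suc j (length lo))) bound) occ

cover-length : ∀ {lo hi} → IsPerm hi → CoveredBy lo hi → length hi ≡ suc (length lo)
cover-length hi-perm (lo≼hi , lo≢hi , no-between) with m≤n⇒m<n∨m≡n (≼-length lo≼hi)
... | inj₂ same = contradiction (≼-same-length hi-perm lo≼hi same) lo≢hi
... | inj₁ shorter with m≤n⇒m<n∨m≡n shorter
...   | inj₂ one-shorter = sym one-shorter
...   | inj₁ two-shorter with pattern-between hi-perm lo≼hi two-shorter
...     | π , π-perm , lo≼π , π≼hi , |π| with no-between π π-perm lo≼π π≼hi
...       | inj₁ refl = contradiction (sym |π|) 1+n≢n
...       | inj₂ refl = contradiction (subst (2 + _ ≤_) |π| two-shorter) (n≮n _)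

cover-position : ∀ {s p w r} → Window s p w → IsPerm w → CoveredBy r w →
  r ≡ std (take (length r) (drop p s)) ⊎ r ≡ std (take (length r) (drop (suc p) s))
cover-position {r = r} win _ ((zero , bound , occ) , _) =
  inj₁ (trans (sym occ) (window-restrict win (length r) 0 bound))
cover-position {r = r} win _ ((suc zero , bound , occ) , _) =
  inj₂ (trans (sym occ) (window-restrict win (length r) 1 bound))
cover-position {r = r} win w-perm cov@((suc (suc j) , bound , _) , _) = contradiction
  (≤-trans (s≤s (s≤s (m≤n+m (length r) j))) (subst (suc (suc j) + length r ≤_) (cover-length w-perm cov) bound))
  (n≮n (suc (length r)))

replaceAt : ∀ {A : Set} → ℕ → A → List A → List A
replaceAt k x rs = take k rs ++ x ∷ drop (suc k) rs

nth-∷ : ∀ {A : Set} {xs : List A} {y ys} k → xs ≡ y ∷ ys → nth xs (suc k) ≡ nth ys k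
nth-∷ k refl = refl

nth-head : ∀ {A : Set} {xs : List A} {y ys z} → xs ≡ y ∷ ys → nth xs 0 ≡ just z → y ≡ z
nth-head refl = just-injective

-- Chain ids.  While chainId walks down a chain of τ, the current pattern prev is the
-- pattern of τ at a window {p+1, …, p+|prev|}; idFrom p prev continues the chain id from there.
module ChainIds (τ : List ℕ) where

  idFrom : ℕ → List ℕ → List (List ℕ) → List ℕ
  idFrom p prev = chainIdGo τ (suc p) (p + length prev) prev

  unfold-monotone : ∀ {a b prev r} rs → monotone prev ≡ true →
    chainIdGo τ a b prev (r ∷ rs) ≡ a ∷ chainIdGo τ (suc a) b r rs
  unfold-monotone rs mono rewrite mono = refl

  unfold-left : ∀ {a b prev r} rs → monotone prev ≡ false → std (take (b ∸ a) (drop a τ)) ≡ r →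
    chainIdGo τ a b prev (r ∷ rs) ≡ a ∷ chainIdGo τ (suc a) b r rs
  unfold-left {a} {b} {r = r} rs mono left rewrite mono | dec-true (≡-dec _≟_ (std (take (b ∸ a) (drop a τ))) r) left = refl

  unfold-right : ∀ {a b prev r} rs → monotone prev ≡ false → std (take (b ∸ a) (drop a τ)) ≢ r →
    chainIdGo τ a b prev (r ∷ rs) ≡ b ∷ chainIdGo τ a (b ∸ 1) r rs
  unfold-right {a} {b} {r = r} rs mono ¬left rewrite mono | dec-false (≡-dec _≟_ (std (take (b ∸ a) (drop a τ))) r) ¬left = refl

  -- One step prev → r of a chain, starting from the window at offset p: its label, the
  -- offset of the new window, and whether the left end (label p+1) or the right end
  -- (label p+|prev|, only for non-monotone prev) of the window was deleted.
  record Step (p : ℕ) (prev r : List ℕ) : Set where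
    field
      label offset : ℕ
      unfold : ∀ rs → idFrom p prev (r ∷ rs) ≡ label ∷ idFrom offset r rs
      next-window : Window τ offset r
      kind : (label ≡ suc p × offset ≡ suc p)
           ⊎ (label ≡ p + length prev × offset ≡ p × monotone prev ≡ false)

  module _ {p prev r} (win : Window τ p prev) (prev-perm : IsPerm prev) (cov : CoveredBy r prev) where
    private
      n = length r
      len : length prev ≡ suc n
      len = cover-length prev-perm cov
      right-end : p + length prev ≡ suc p + n
      right-end = trans (cong (p +_) len) (+-suc p n)
      test-width : p + length prev ∸ suc p ≡ n
      test-width = trans (cong (_∸ suc p) right-end) (m+n∸m≡n (suc p) n)

      left-step : (∀ rs → idFrom p prev (r ∷ rs) ≡ suc p ∷ chainIdGo τ (suc (suc p)) (p + length prev) r rs) →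
        r ≡ std (take n (drop (suc p) τ)) → Step p prev r
      left-step unfold r≡ = record
        { label = suc p ; offset = suc p
        ; unfold = λ rs → trans (unfold rs) (cong (λ b → suc p ∷ chainIdGo τ (suc (suc p)) b r rs) right-end)
        ; next-window = window (subst (_≤ length τ) right-end (Window.fits win)) r≡
        ; kind = inj₁ (refl , refl) }

      right-step : monotone prev ≡ false →
        (∀ rs → idFrom p prev (r ∷ rs) ≡ p + length prev ∷ chainIdGo τ (suc p) (p + length prev ∸ 1) r rs) →
        r ≡ std (take n (drop p τ)) → Step p prev r
      right-step mono unfold r≡ = record
        { label = p + length prev ; offset = p
        ; unfold = λ rs → trans (unfold rs) (cong (λ b → p + length prev ∷ chainIdGo τ (suc p) b r rs) (cong (_∸ 1) right-end))
        ; next-window = window (≤-trans (+-monoʳ-≤ p (n≤1+n n)) (subst (_≤ length τ) (cong (p +_) len) (Window.fits win))) r≡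
        ; kind = inj₂ (refl , refl , mono) }

      -- in a monotone window both deletions leave the same pattern
      monotone-left : monotone prev ≡ true → r ≡ std (take n (drop p τ)) → r ≡ std (take n (drop (suc p) τ))
      monotone-left mono at-p = trans at-p (begin
        std (take n (drop p τ))          ≡⟨ window-restrict win n 0 (≤-trans (n≤1+n n) (≤-reflexive (sym len))) ⟨
        std (take n prev)                ≡⟨ monotone-windows prev mono len ⟩
        std (take n (drop 1 prev))       ≡⟨ window-restrict win n 1 (≤-reflexive (sym len)) ⟩
        std (take n (drop (suc p) τ))    ∎)
        where open ≡-Reasoning

    step : Step p prev r
    step with cover-position win prev-perm cov | monotone prev in mono
    ... | inj₁ at-p     | true = left-step (λ rs → unfold-monotone {prev = prev} rs mono) (monotone-left mono at-p)
    ... | inj₂ at-suc-p | true = left-step (λ rs → unfold-monotone {prev = prev} rs mono) at-suc-p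
    ... | position | false with ≡-dec _≟_ (std (take (p + length prev ∸ suc p) (drop (suc p) τ))) r
    ...   | yes left = left-step (λ rs → unfold-left {prev = prev} rs mono left)
              (trans (sym left) (cong (λ k → std (take k (drop (suc p) τ))) test-width))
    ...   | no ¬left with position
    ...     | inj₁ at-p = right-step mono (λ rs → unfold-right {prev = prev} rs mono ¬left) at-p
    ...     | inj₂ at-suc-p = contradiction
              (trans (cong (λ k → std (take k (drop (suc p) τ))) test-width) (sym at-suc-p)) ¬left

  label-above : ∀ {q w r} (s : Step q w r) → 1 ≤ length w → suc q ≤ Step.label s
  label-above {q} {w} s 1≤|w| with Step.kind s
  ... | inj₁ (label≡ , _) = ≤-reflexive (sym label≡)
  ... | inj₂ (label≡ , _) = subst (suc q ≤_) (sym label≡) (subst (_≤ q + length w) (+-comm q 1) (+-monoʳ-≤ q 1≤|w|))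

  -- At a strong descent the first step deletes the right end of a non-monotone window
  -- and the second step deletes the left end of the remaining window.
  strong-descent-shape : ∀ {p prev ρ ρ₂} (s₁ : Step p prev ρ) (s₂ : Step (Step.offset s₁) ρ ρ₂) →
    1 ≤ length ρ → length prev ≡ suc (length ρ) → Step.label s₂ + 1 < Step.label s₁ →
    monotone prev ≡ false × Step.label s₂ ≡ suc p × Step.offset s₂ ≡ suc p
  strong-descent-shape {p} {prev} {ρ} s₁ s₂ 1≤|ρ| len descent with Step.kind s₁ | Step.kind s₂
  ... | inj₁ (label₁≡ , offset₁≡) | _ = contradiction (begin-strict
    Step.offset s₁     <⟨ label-above s₂ 1≤|ρ| ⟩
    Step.label s₂      ≤⟨ m≤m+n (Step.label s₂) 1 ⟩
    Step.label s₂ + 1  <⟨ descent ⟩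
    Step.label s₁      ≡⟨ trans label₁≡ (sym offset₁≡) ⟩
    Step.offset s₁     ∎) (n≮n _)
    where open ≤-Reasoning
  ... | inj₂ (label₁≡ , offset₁≡ , _) | inj₂ (label₂≡ , _ , _) = contradiction (subst (_< Step.label s₁) weak descent) (n≮n _)
    where
    open ≡-Reasoning
    weak : Step.label s₂ + 1 ≡ Step.label s₁
    weak = begin
      Step.label s₂ + 1   ≡⟨ cong (_+ 1) (trans label₂≡ (cong (_+ length ρ) offset₁≡)) ⟩
      p + length ρ + 1    ≡⟨ +-assoc p (length ρ) 1 ⟩
      p + (length ρ + 1)  ≡⟨ cong (p +_) (trans (+-comm (length ρ) 1) (sym len)) ⟩
      p + length prev     ≡⟨ label₁≡ ⟨
      Step.label s₁       ∎
  ... | inj₂ (_ , offset₁≡ , mono) | inj₁ (label₂≡ , offset₂≡) =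
    mono , trans label₂≡ (cong suc offset₁≡) , trans offset₂≡ (cong suc offset₁≡)

  -- the pattern left after deleting the left end of the window at offset p of length |prev|;
  -- this is the candidate chainIdGo tests first
  deleteLeft : ℕ → List ℕ → List ℕ
  deleteLeft p prev = std (take (p + length prev ∸ suc p) (drop (suc p) τ))

  -- If ρ₂ arises from prev by deleting both ends of its window, deleting the left end first
  -- gives a pattern strictly between them.
  swap : IsPerm τ → ∀ {p prev ρ₂} → Window τ p prev → IsPerm prev → Window τ (suc p) ρ₂ →
    length prev ≡ suc (suc (length ρ₂)) →
    IsPerm (deleteLeft p prev) × CoveredBy (deleteLeft p prev) prev × CoveredBy ρ₂ (deleteLeft p prev)
  swap τ-perm {p} {prev} {ρ₂} win prev-perm win₂ len =
    subst (λ k → Between (std (take k (drop (suc p) τ)))) (sym width) (x-perm , x-below-prev , ρ₂-below-x)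
    where
    Between : List ℕ → Set
    Between x = IsPerm x × CoveredBy x prev × CoveredBy ρ₂ x
    n = suc (length ρ₂)
    x = std (take n (drop (suc p) τ))
    width : p + length prev ∸ suc p ≡ n
    width = trans (cong (λ k → p + k ∸ suc p) len) (trans (cong (_∸ suc p) (+-suc p n)) (m+n∸m≡n p n))
    bound : suc p + n ≤ length τ
    bound = subst (_≤ length τ) (trans (cong (p +_) len) (+-suc p n)) (Window.fits win)
    |x| : length x ≡ n
    |x| = length-std-window n (suc p) τ bound
    x-perm : IsPerm x
    x-perm = std-unique (Unique.take⁺ n (Unique.drop⁺ {xs = τ} (suc p) (perm-unique τ-perm)))
      (subst (1 ≤_) (sym (length-window n (suc p) τ bound)) (s≤s z≤n))
    x-below-prev : CoveredBy x prev
    x-below-prev = cover-by-length prev-perm (sub-window win n 1 (≤-reflexive (sym len))) (trans len (cong suc (sym |x|)))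
    ρ₂-below-x : CoveredBy ρ₂ x
    ρ₂-below-x = cover-by-length x-perm
      (subst (_≼ x) (sym (Window.occurrence win₂)) (sub-window (window-of-std n (suc p) τ bound) (length ρ₂) 0
        (≤-trans (n≤1+n _) (≤-reflexive (sym |x|)))))
      |x|

  Cover : List ℕ → List ℕ → Set
  Cover a b = CoveredBy b a

  record Detour (p : ℕ) (prev : List ℕ) (rs : List (List ℕ)) (k : ℕ) : Set where
    field
      x : List ℕ
      perms : All IsPerm (replaceAt k x rs)
      linked : Linked Cover (prev ∷ replaceAt k x rs)
      earlier : LexLt (idFrom p prev (replaceAt k x rs)) (idFrom p prev rs)
      same-end : last (prev ∷ replaceAt k x rs) ≡ last (prev ∷ rs)

  detour : IsPerm τ → ∀ k {p prev rs l l′} → Window τ p prev → IsPerm prev → All IsPerm rs →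
    Linked Cover (prev ∷ rs) → nth (idFrom p prev rs) k ≡ just l → nth (idFrom p prev rs) (suc k) ≡ just l′ →
    l′ + 1 < l → Detour p prev rs k
  detour τ-perm k {rs = []} _ _ _ _ () _ _
  detour τ-perm zero {rs = ρ ∷ []} win prev-perm _ (cov ∷ _) _ at-1 _
    with () ← trans (sym (nth-∷ 0 (Step.unfold (step win prev-perm cov) []))) at-1
  detour τ-perm zero {p} {prev} {ρ ∷ ρ₂ ∷ rest} {l} {l′} win prev-perm (ρ-perm ∷ ρ₂-perm ∷ perms)
    (cov₁ ∷ cov₂ ∷ linked) at-0 at-1 descent =
    record { x = deleteLeft p prev
           ; perms = proj₁ between ∷ ρ₂-perm ∷ perms
           ; linked = proj₁ (proj₂ between) ∷ proj₂ (proj₂ between) ∷ linked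
           ; earlier = subst₂ LexLt (sym (unfold-left {prev = prev} (ρ₂ ∷ rest) mono refl))
                                    (sym (S₁.unfold (ρ₂ ∷ rest))) (here left<right)
           ; same-end = refl }
    where
    s₁ : Step p prev ρ
    s₁ = step win prev-perm cov₁
    module S₁ = Step s₁
    s₂ : Step S₁.offset ρ ρ₂
    s₂ = step S₁.next-window ρ-perm cov₂
    module S₂ = Step s₂
    label₁≡ : S₁.label ≡ l
    label₁≡ = nth-head (S₁.unfold (ρ₂ ∷ rest)) at-0
    label₂≡ : S₂.label ≡ l′
    label₂≡ = nth-head (S₂.unfold rest) (trans (sym (nth-∷ 0 (S₁.unfold (ρ₂ ∷ rest)))) at-1)
    descent′ : S₂.label + 1 < S₁.label
    descent′ = subst₂ (λ a b → a + 1 < b) (sym label₂≡) (sym label₁≡) descent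
    len₁ : length prev ≡ suc (length ρ)
    len₁ = cover-length prev-perm cov₁
    shape : monotone prev ≡ false × S₂.label ≡ suc p × S₂.offset ≡ suc p
    shape = strong-descent-shape s₁ s₂ (proj₁ ρ-perm) len₁ descent′
    mono : monotone prev ≡ false
    mono = proj₁ shape
    left<right : suc p < S₁.label
    left<right = ≤-<-trans (m≤m+n (suc p) 1) (subst (λ a → a + 1 < S₁.label) (proj₁ (proj₂ shape)) descent′)
    between : IsPerm (deleteLeft p prev) × CoveredBy (deleteLeft p prev) prev × CoveredBy ρ₂ (deleteLeft p prev)
    between = swap τ-perm win prev-perm (subst (λ o → Window τ o ρ₂) (proj₂ (proj₂ shape)) S₂.next-window)
      (trans len₁ (cong suc (cover-length ρ-perm cov₂)))
  detour τ-perm (suc k) {p} {prev} {ρ ∷ rs} win prev-perm (ρ-perm ∷ perms) (cov ∷ linked) at-k at-k+1 descent =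
    record { x = D.x ; perms = ρ-perm ∷ D.perms ; linked = cov ∷ D.linked
           ; earlier = subst₂ LexLt (sym (S.unfold (replaceAt k D.x rs))) (sym (S.unfold rs)) (there D.earlier)
           ; same-end = D.same-end }
    where
    module S = Step (step win prev-perm cov)
    module D = Detour (detour τ-perm k S.next-window ρ-perm perms linked
      (trans (sym (nth-∷ k (S.unfold rs))) at-k) (trans (sym (nth-∷ (suc k) (S.unfold rs))) at-k+1) descent)

  chainIdGo-length : ∀ a b prev rs → length (chainIdGo τ a b prev rs) ≡ length rs
  chainIdGo-length a b prev [] = refl
  chainIdGo-length a b prev (r ∷ rs) with monotone prev
  ... | true = cong suc (chainIdGo-length (suc a) b r rs)
  ... | false with does (≡-dec _≟_ (std (take (b ∸ a) (drop a τ))) r)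
  ...   | true = cong suc (chainIdGo-length (suc a) b r rs)
  ...   | false = cong suc (chainIdGo-length a (b ∸ 1) r rs)

nth-length : ∀ {A : Set} (xs : List A) k {v} → nth xs k ≡ just v → k < length xs
nth-length (x ∷ xs) zero _ = s≤s z≤n
nth-length (x ∷ xs) (suc k) at-k = s≤s (nth-length xs k at-k)

interval-around : ∀ (C : List (List ℕ)) k → intervalC C k (suc k + 1) ≡ take 1 (drop (suc k) C)
interval-around C k = cong (λ n → take n (drop (suc k) C)) (m+n∸m≡n (suc k) 1)

take-1-nonempty : ∀ {A : Set} (xs : List A) k → k < length xs → take 1 (drop k xs) ≢ []
take-1-nonempty (x ∷ xs) zero _ ()
take-1-nonempty (x ∷ xs) (suc k) (s≤s k<n) = take-1-nonempty xs k k<n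

single-minimal : ∀ {A : Set} {I : List A} ys → I ≢ [] → I ⊆ take 1 ys → take 1 ys ⊆ I
single-minimal {I = []} ys I≢[] _ = contradiction refl I≢[]
single-minimal {I = y ∷ I} [] _ I⊆ with () ← I⊆ (here refl)
single-minimal {I = y ∷ I} (z ∷ ys) _ I⊆ (here refl) with here refl ← I⊆ (here refl) = here refl

outside-replaceAt : ∀ (C : List (List ℕ)) k x → outsideC C k (suc k + 1) ⊆ replaceAt (suc k) x C
outside-replaceAt C k x = ++⁺ʳ (take (suc k) C)
  (subst (λ j → drop j C ⊆ x ∷ drop (suc (suc k)) C) (+-comm 1 (suc k)) (xs⊆x∷xs _ x))

-- The detour around ρ_i gives the earlier chain C′ that skips {ρ_i}; minimality is automatic.
lemma2p2 : (σ τ : List ℕ) → IsPerm σ → IsPerm τ → σ ≼ τ →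
    (C : List (List ℕ)) → MaxChain σ τ C →
    (i l l' : ℕ) → 1 ≤ i → i ≤ (length τ ∸ length σ) ∸ 1 →
    nth (chainId τ C) (i ∸ 1) ≡ just l → nth (chainId τ C) i ≡ just l' →
    l' + 1 < l →
    MSI σ τ C (i ∸ 1) (i + 1)
lemma2p2 σ τ _ τ-perm _ (.τ ∷ rs) (refl , ends , _ ∷ perms , linked) (suc k) _ _ _ _ at-k at-k+1 descent =
  (k<j , fits , nonempty , C′ , chain′ , D.earlier , outside-replaceAt (τ ∷ rs) k D.x) , minimal
  where
  open ChainIds τ
  module D = Detour (detour τ-perm k (window-whole τ-perm) τ-perm perms linked at-k at-k+1 descent)
  C′ : List (List ℕ)
  C′ = τ ∷ replaceAt k D.x rs
  chain′ : MaxChain σ τ C′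
  chain′ = refl , trans D.same-end ends , τ-perm ∷ D.perms , D.linked
  k+1<|rs| : suc k < length rs
  k+1<|rs| = subst (suc k <_) (chainIdGo-length 1 (length τ) τ rs) (nth-length (chainId τ (τ ∷ rs)) (suc k) at-k+1)
  k<j : k < suc k + 1
  k<j = m≤m+n (suc k) 1
  fits : suc (suc k + 1) ≤ length (τ ∷ rs)
  fits = s≤s (subst (_≤ length rs) (+-comm 1 (suc k)) k+1<|rs|)
  nonempty : intervalC (τ ∷ rs) k (suc k + 1) ≢ []
  nonempty = subst (_≢ []) (sym (interval-around (τ ∷ rs) k)) (take-1-nonempty rs k (<-trans (n<1+n k) k+1<|rs|))
  minimal : ∀ i′ j′ → Skipped σ τ (τ ∷ rs) i′ j′ →
    ¬ (intervalC (τ ∷ rs) i′ j′ ⊆ intervalC (τ ∷ rs) k (suc k + 1) × ¬ (intervalC (τ ∷ rs) k (suc k + 1) ⊆ intervalC (τ ∷ rs) i′ j′))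
  minimal i′ j′ (_ , _ , nonempty′ , _) (inside , proper) rewrite interval-around (τ ∷ rs) k =
    proper (single-minimal (drop (suc k) (τ ∷ rs)) nonempty′ inside)
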